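{- Let $R(x,y) = \sum_{a,k\ge 0} r_{a,k}x^ay^k$, where $r_{a,k}$ is the number of independent sets of size $k$ in the updown-core $UD(B_a)$. Then \[ R = 1 + xR + \frac{xyR}{1-x}. \]
   Context: A boundary grid is a finite set $B \subset \mathbb{Z}^2$ of boxes (unit squares indexed by lower-left corners). The updown-core $UD(B)$ is the simple graph with vertex set $B$ in which two distinct boxes $(i,j)$ and $(k,\ell)$ are adjacent if and only if every box $(s,t)$ with $\min(i,k)\le s\le \max(i,k)$ and $\min(j,\ell)\le t\le \max(j,\ell)$ lies in $B$. For $a\ge 0$, $B_a = \{(x,y)\in\mathbb{Z}^2 : 1\le x\le a,\ 1\le y\le a,\ x+y\ge a+1\}$. Independent sets include the empty set; a graph with no vertices has one independent set. -}

module Defs where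

open import Data.Nat using (ℕ; zero; suc; _+_; _*_; _∸_; _≤ᵇ_; _≡ᵇ_; _⊔_; _⊓_)
open import Data.Bool using (Bool; true; false; _∧_; not; if_then_else_)
open import Data.List using (List; []; _∷_; map; filter; length; concatMap; _++_; foldr)
open import Data.Product using (_×_; _,_; proj₁; proj₂)

-- A box is indexed by its lower-left corner.  All boxes relevant here
-- (those of B_a and the rectangles spanned by them) have coordinates ≥ 1,
-- so ℕ × ℕ coordinates suffice.
Box : Set
Box = ℕ × ℕ

allB : {A : Set} → (A → Bool) → List A → Bool
allB p [] = true
allB p (x ∷ xs) = p x ∧ allB p xs

range : ℕ → ℕ → List ℕ
range lo hi = map (λ i → lo + i) (upto (suc hi ∸ lo))
  where
  upto : ℕ → List ℕ
  upto zero = []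
  upto (suc n) = upto n ++ (n ∷ [])

inB : ℕ → Box → Bool
inB a (x , y) = (1 ≤ᵇ x) ∧ (x ≤ᵇ a) ∧ (1 ≤ᵇ y) ∧ (y ≤ᵇ a) ∧ (suc a ≤ᵇ x + y)

boxesB : ℕ → List Box
boxesB a = filter (λ b → Data.Bool._≟_ (inB a b) true)
                  (concatMap (λ x → map (λ y → (x , y)) (range 1 a)) (range 1 a))
  where import Data.Bool

boxEq : Box → Box → Bool
boxEq (i , j) (k , l) = (i ≡ᵇ k) ∧ (j ≡ᵇ l)

-- adjacency in the updown-core UD(B) of a boundary grid B (given by a
-- membership predicate): distinct, and every box of the spanned rectangle is in B
udAdj : (Box → Bool) → Box → Box → Bool
udAdj B (i , j) (k , l) =
  not (boxEq (i , j) (k , l)) ∧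
  allB (λ s → allB (λ t → B (s , t)) (range (j ⊓ l) (j ⊔ l))) (range (i ⊓ k) (i ⊔ k))

independent : (Box → Bool) → List Box → Bool
independent B [] = true
independent B (v ∷ vs) = allB (λ w → not (udAdj B v w)) vs ∧ independent B vs

-- all sublists (= all subsets, for a duplicate-free list)
sublists : {A : Set} → List A → List (List A)
sublists [] = [] ∷ []
sublists (x ∷ xs) = sublists xs ++ map (x ∷_) (sublists xs)

count : {A : Set} → (A → Bool) → List A → ℕ
count p [] = 0
count p (x ∷ xs) = (if p x then 1 else 0) + count p xs

r : ℕ → ℕ → ℕ
r a k = count (λ S → (length S ≡ᵇ k) ∧ independent (inB a) S) (sublists (boxesB a))

-- Formal power series in x, y with ℕ coefficients: f a k = [x^a y^k] f

PS : Set
PS = ℕ → ℕ → ℕ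

sumTo : ℕ → (ℕ → ℕ) → ℕ
sumTo zero f = f 0
sumTo (suc n) f = sumTo n f + f (suc n)

_⊕_ : PS → PS → PS
(f ⊕ g) a k = f a k + g a k

_⊛_ : PS → PS → PS
(f ⊛ g) a k = sumTo a (λ i → sumTo k (λ j → f i j * g (a ∸ i) (k ∸ j)))

infixl 6 _⊕_
infixl 7 _⊛_

one : PS
one zero zero = 1
one _ _ = 0

X : PS
X 1 zero = 1
X _ _ = 0

Y : PS
Y zero 1 = 1
Y _ _ = 0

-- 1/(1-x) = Σ_{j ≥ 0} x^j
geomX : PS
geomX a zero = 1
geomX a (suc k) = 0

R : PS
R = r

-- Boxes of one column of B_a are pairwise adjacent in UD(B_a), and a box (c, y) of B_a is
-- adjacent to a box further right exactly when that box lies above row a − c.  So an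
-- independent set of size k + 1 is its leftmost box, one of the c boxes of some column c,
-- together with an independent k-set among the boxes right of column c and not above row
-- a − c, which form a translate of B_(a−c).  Hence r_(a,k+1) = Σ_{c=1}^{a} c · r_(a−c,k), i.e.
-- R = 1/(1 − x) + xyR/(1 − x)², and multiplying by 1 − x gives the identity.  Coefficientwise
-- it reads r_(a+1,k+1) = r_(a,k+1) + Σ_{i≤a} r_(i,k), r_(0,k+1) = 0 and r_(a,0) = 1.

module Submission where

open import Defs
open import Data.Bool using (Bool; true; false; _∧_; not; if_then_else_; T)
import Data.Bool
open import Data.Bool.Properties using (∧-assoc; ∧-comm; ∧-zeroʳ; T-∧; T-≡; T-not-≡; if-eta)
open import Data.Empty using (⊥-elim)
open import Data.List using (List; []; _∷_; _++_; map; length; concat; concatMap; filterᵇ)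
open import Data.List.Properties
  using (map-++; map-∘; map-cong-local; length-map; concatMap-map; map-concatMap;
         filter-++; filter-all; filter-none; filter-≐; ++-identityʳ)
open import Data.List.Relation.Unary.All using (All; []; _∷_)
import Data.List.Relation.Unary.All as All
open import Data.List.Relation.Unary.All.Properties using (all-filter; filter⁺)
import Data.List.Relation.Unary.All.Properties as All
open import Data.List.Relation.Unary.AllPairs using (AllPairs; []; _∷_)
import Data.List.Relation.Unary.AllPairs.Properties as AllPairs
open import Data.Nat
open import Data.Nat.ListAction using (sum)
open import Data.Nat.Properties
open import Data.Nat.Tactic.RingSolver using (solve-∀)
open import Data.Product using (_×_; _,_)
open import Data.Sum using (_⊎_; inj₁; inj₂)
open import Function using (_∘_)
open import Function.Bundles using (Equivalence; mk⇔)
open import Relation.Binary.PropositionalEquality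
open import Relation.Nullary using (¬_; yes; no)
open import Relation.Nullary.Decidable using (dec-true; dec-false; does-⇔; T?)

private variable A B : Set

T-∧-intro : ∀ {a b} → T a → T b → T (a ∧ b)
T-∧-intro ta tb = Equivalence.from T-∧ (ta , tb)

T⇒¬T-not : ∀ {b} → T b → ¬ T (not b)
T⇒¬T-not {true} _ ()

∧-swapˡ : ∀ a b c → a ∧ (b ∧ c) ≡ b ∧ (a ∧ c)
∧-swapˡ a b c = trans (sym (∧-assoc a b c)) (trans (cong (_∧ c) (∧-comm a b)) (∧-assoc b a c))

allB⁺ : ∀ {p : A → Bool} {xs} → All (T ∘ p) xs → T (allB p xs)
allB⁺ [] = _
allB⁺ (px ∷ pxs) = T-∧-intro px (allB⁺ pxs)

filterᵇ-cong : ∀ {p q : A → Bool} {xs} → All (λ x → p x ≡ q x) xs → filterᵇ p xs ≡ filterᵇ q xs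
filterᵇ-cong [] = refl
filterᵇ-cong {p = p} {q} {x ∷ xs} (px≡qx ∷ eqs) with p x | q x
... | true  | true  = cong (x ∷_) (filterᵇ-cong eqs)
... | false | false = filterᵇ-cong eqs
... | true  | false with () ← px≡qx
... | false | true  with () ← px≡qx

filterᵇ-map : ∀ (p : B → Bool) (f : A → B) xs → filterᵇ p (map f xs) ≡ map f (filterᵇ (p ∘ f) xs)
filterᵇ-map p f [] = refl
filterᵇ-map p f (x ∷ xs) with p (f x)
... | true  = cong (f x ∷_) (filterᵇ-map p f xs)
... | false = filterᵇ-map p f xs

filterᵇ-concatMap : ∀ (p : B → Bool) (f : A → List B) xs → filterᵇ p (concatMap f xs) ≡ concatMap (filterᵇ p ∘ f) xs
filterᵇ-concatMap p f [] = refl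
filterᵇ-concatMap p f (x ∷ xs) = trans (filter-++ (T? ∘ p) (f x) _) (cong (filterᵇ p (f x) ++_) (filterᵇ-concatMap p f xs))

filterᵇ-++-all-none : ∀ {p : A → Bool} {xs ys} → All (T ∘ p) xs → All (¬_ ∘ T ∘ p) ys → filterᵇ p (xs ++ ys) ≡ xs
filterᵇ-++-all-none {p = p} {xs} {ys} all none =
  trans (filter-++ (T? ∘ p) xs ys)
        (trans (cong₂ _++_ (filter-all (T? ∘ p) all) (filter-none (T? ∘ p) none)) (++-identityʳ xs))

filterᵇ-++-none-all : ∀ {p : A → Bool} {xs ys} → All (¬_ ∘ T ∘ p) xs → All (T ∘ p) ys → filterᵇ p (xs ++ ys) ≡ ys
filterᵇ-++-none-all {p = p} {xs} {ys} none all =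
  trans (filter-++ (T? ∘ p) xs ys) (cong₂ _++_ (filter-none (T? ∘ p) none) (filter-all (T? ∘ p) all))

-- Independent sets

count-++ : ∀ (p : A → Bool) xs ys → count p (xs ++ ys) ≡ count p xs + count p ys
count-++ p [] ys = refl
count-++ p (x ∷ xs) ys = trans (cong (_ +_) (count-++ p xs ys)) (sym (+-assoc (if p x then 1 else 0) _ _))

count-map : ∀ (p : B → Bool) (f : A → B) xs → count p (map f xs) ≡ count (p ∘ f) xs
count-map p f [] = refl
count-map p f (x ∷ xs) = cong (_ +_) (count-map p f xs)

count-cong : ∀ {p q : A → Bool} → (∀ x → p x ≡ q x) → ∀ xs → count p xs ≡ count q xs
count-cong p≗q [] = refl
count-cong p≗q (x ∷ xs) = cong₂ (λ b n → (if b then 1 else 0) + n) (p≗q x) (count-cong p≗q xs)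

count-false : ∀ xs → count {A} (λ _ → false) xs ≡ 0
count-false [] = refl
count-false (x ∷ xs) = count-false xs

count-sublists-∷ : ∀ (p : List A → Bool) x xs →
  count p (sublists (x ∷ xs)) ≡ count p (sublists xs) + count (p ∘ (x ∷_)) (sublists xs)
count-sublists-∷ p x xs = trans (count-++ p (sublists xs) _) (cong (_ +_) (count-map p (x ∷_) (sublists xs)))

count-sublists-allB : ∀ (P : A → Bool) (f : List A → Bool) xs →
  count (λ S → allB P S ∧ f S) (sublists xs) ≡ count f (sublists (filterᵇ P xs))
count-sublists-allB P f [] = refl
count-sublists-allB P f (x ∷ xs) with P x in px
... | true =
  trans (count-sublists-∷ (λ S → allB P S ∧ f S) x xs)
    (trans (cong₂ _+_ (count-sublists-allB P f xs)
                      (trans (count-cong (λ S → cong (λ b → (b ∧ allB P S) ∧ f (x ∷ S)) px) (sublists xs))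
                             (count-sublists-allB P (f ∘ (x ∷_)) xs)))
           (sym (count-sublists-∷ f x (filterᵇ P xs))))
... | false =
  trans (count-sublists-∷ (λ S → allB P S ∧ f S) x xs)
    (trans (cong₂ _+_ (count-sublists-allB P f xs)
                      (trans (count-cong (λ S → cong (λ b → (b ∧ allB P S) ∧ f (x ∷ S)) px) (sublists xs))
                             (count-false (sublists xs))))
           (+-identityʳ _))

independentCount : (A → A → Bool) → List A → ℕ → ℕ
independentCount adj xs zero = 1
independentCount adj [] (suc k) = 0
independentCount adj (x ∷ xs) (suc k) =
  independentCount adj xs (suc k) + independentCount adj (filterᵇ (not ∘ adj x) xs) k

count-independent : ∀ (B : Box → Bool) xs k →
  count (λ S → (length S ≡ᵇ k) ∧ independent B S) (sublists xs) ≡ independentCount (udAdj B) xs k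
count-independent B [] zero = refl
count-independent B [] (suc k) = refl
count-independent B (x ∷ xs) zero =
  trans (count-sublists-∷ _ x xs) (cong₂ _+_ (count-independent B xs zero) (count-false (sublists xs)))
count-independent B (x ∷ xs) (suc k) =
  trans (count-sublists-∷ _ x xs) (cong₂ _+_ (count-independent B xs (suc k)) withHead)
  where
  withHead : count (λ S → (length S ≡ᵇ k) ∧ (allB (not ∘ udAdj B x) S ∧ independent B S)) (sublists xs)
           ≡ independentCount (udAdj B) (filterᵇ (not ∘ udAdj B x) xs) k
  withHead = trans (count-cong (λ S → ∧-swapˡ (length S ≡ᵇ k) (allB (not ∘ udAdj B x) S) (independent B S)) (sublists xs))
                   (trans (count-sublists-allB (not ∘ udAdj B x) _ xs)
                          (count-independent B (filterᵇ (not ∘ udAdj B x) xs) k))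

independentCount-cong : ∀ (Q : A → Set) {adj adj' : A → A → Bool} →
  (∀ {v w} → Q v → Q w → adj v w ≡ adj' v w) →
  ∀ {xs} → All Q xs → ∀ k → independentCount adj xs k ≡ independentCount adj' xs k
independentCount-cong Q agree _ zero = refl
independentCount-cong Q agree [] (suc k) = refl
independentCount-cong Q {adj} {adj'} agree {x ∷ xs} (qx ∷ qxs) (suc k) =
  cong₂ _+_ (independentCount-cong Q agree qxs (suc k))
    (trans (cong (λ ys → independentCount adj ys k) (filterᵇ-cong (All.map (λ qw → cong not (agree qx qw)) qxs)))
           (independentCount-cong Q agree (filter⁺ (T? ∘ (not ∘ adj' x)) qxs) k))

independentCount-map : ∀ (f : A → B) {adj : B → B → Bool} {adj' : A → A → Bool} →
  (∀ v w → adj (f v) (f w) ≡ adj' v w) → ∀ xs k → independentCount adj (map f xs) k ≡ independentCount adj' xs k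
independentCount-map f hom xs zero = refl
independentCount-map f hom [] (suc k) = refl
independentCount-map f {adj} {adj'} hom (x ∷ xs) (suc k) =
  cong₂ _+_ (independentCount-map f hom xs (suc k))
    (trans (cong (λ ys → independentCount adj ys k) (filterᵇ-map (not ∘ adj (f x)) f xs))
    (trans (independentCount-map f hom (filterᵇ (not ∘ adj (f x) ∘ f) xs) k)
           (cong (λ ys → independentCount adj' ys k) (filterᵇ-cong (All.universal (λ w → cong not (hom x w)) xs)))))

independentCount-clique-++ : ∀ {A : Set} (adj : A → A → Bool) {C} → AllPairs (λ v w → T (adj v w)) C → ∀ D k →
  independentCount adj (C ++ D) (suc k) ≡
  independentCount adj D (suc k) + sum (map (λ c → independentCount adj (filterᵇ (not ∘ adj c) D) k) C)
independentCount-clique-++ adj [] D k = sym (+-identityʳ _)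
independentCount-clique-++ {A} adj {c ∷ C} (adjC ∷ clique) D k = begin
    independentCount adj (C ++ D) (suc k) + independentCount adj (filterᵇ (not ∘ adj c) (C ++ D)) k
  ≡⟨ cong₂ _+_ (independentCount-clique-++ adj clique D k) (cong (λ ys → independentCount adj ys k) nonNeighbours) ⟩
    (independentCount adj D (suc k) + sum (map g C)) + g c
  ≡⟨ +-assoc (independentCount adj D (suc k)) _ _ ⟩
    independentCount adj D (suc k) + (sum (map g C) + g c)
  ≡⟨ cong (independentCount adj D (suc k) +_) (+-comm (sum (map g C)) (g c)) ⟩
    independentCount adj D (suc k) + sum (map g (c ∷ C)) ∎
  where
  open ≡-Reasoning
  g : A → ℕ
  g c = independentCount adj (filterᵇ (not ∘ adj c) D) k
  nonNeighbours : filterᵇ (not ∘ adj c) (C ++ D) ≡ filterᵇ (not ∘ adj c) D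
  nonNeighbours = trans (filter-++ (T? ∘ (not ∘ adj c)) C D)
                        (cong (_++ _) (filter-none (T? ∘ (not ∘ adj c)) (All.map T⇒¬T-not adjC)))

interval : ℕ → ℕ → List ℕ
interval lo zero = []
interval lo (suc n) = lo ∷ interval (suc lo) n

interval-++ : ∀ lo m n → interval lo (m + n) ≡ interval lo m ++ interval (lo + m) n
interval-++ lo zero n = cong (λ l → interval l n) (sym (+-identityʳ lo))
interval-++ lo (suc m) n =
  cong (lo ∷_) (trans (interval-++ (suc lo) m n) (cong (λ l → interval (suc lo) m ++ interval l n) (sym (+-suc lo m))))

interval-snoc : ∀ lo n → interval lo (suc n) ≡ interval lo n ++ (lo + n ∷ [])
interval-snoc lo n = subst (λ m → interval lo m ≡ interval lo n ++ (lo + n ∷ [])) (+-comm n 1) (interval-++ lo n 1)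

length-interval : ∀ lo n → length (interval lo n) ≡ n
length-interval lo zero = refl
length-interval lo (suc n) = cong suc (length-interval (suc lo) n)

map-interval : ∀ (f : ℕ → ℕ) → (∀ i → f (suc i) ≡ suc (f i)) → ∀ lo n → map f (interval lo n) ≡ interval (f lo) n
map-interval f f-suc lo zero = refl
map-interval f f-suc lo (suc n) = cong (f lo ∷_) (trans (map-interval f f-suc (suc lo) n) (cong (λ l → interval l n) (f-suc lo)))

All-interval : ∀ {P : ℕ → Set} lo n → (∀ {s} → lo ≤ s → s < lo + n → P s) → All P (interval lo n)
All-interval lo zero bounded = []
All-interval lo (suc n) bounded =
  bounded ≤-refl (m<m+n lo z<s) ∷
  All-interval (suc lo) n (λ {s} lo<s s<hi → bounded (<⇒≤ lo<s) (subst (s <_) (sym (+-suc lo n)) s<hi))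

AllPairs-interval : ∀ {R : ℕ → ℕ → Set} lo n → (∀ {y y'} → lo ≤ y → y < y' → R y y') → AllPairs R (interval lo n)
AllPairs-interval lo zero _ = []
AllPairs-interval lo (suc n) related =
  All-interval (suc lo) n (λ lo<y _ → related ≤-refl lo<y) ∷ AllPairs-interval (suc lo) n (λ lo<y → related (<⇒≤ lo<y))

range0≡interval : ∀ hi → range 0 hi ≡ interval 0 (suc hi)
range0≡interval zero = refl
range0≡interval (suc hi) = begin
    range 0 (suc hi)
  ≡⟨ map-++ (λ i → 0 + i) _ (suc hi ∷ []) ⟩
    range 0 hi ++ (suc hi ∷ [])
  ≡⟨ cong (_++ (suc hi ∷ [])) (range0≡interval hi) ⟩
    interval 0 (suc hi) ++ (suc hi ∷ [])
  ≡⟨ interval-snoc 0 (suc hi) ⟨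
    interval 0 (suc (suc hi)) ∎
  where open ≡-Reasoning

range≡interval : ∀ lo hi → range lo hi ≡ interval lo (suc hi ∸ lo)
range≡interval zero hi = range0≡interval hi
range≡interval (suc zero) zero = refl
range≡interval (suc (suc lo)) zero = refl
range≡interval (suc lo) (suc hi) = begin
    range (suc lo) (suc hi)
  ≡⟨ map-∘ _ ⟩
    map suc (range lo hi)
  ≡⟨ cong (map suc) (range≡interval lo hi) ⟩
    map suc (interval lo (suc hi ∸ lo))
  ≡⟨ map-interval suc (λ _ → refl) lo _ ⟩
    interval (suc lo) (suc hi ∸ lo) ∎
  where open ≡-Reasoning

<-interval-end : ∀ {lo hi s} → lo ≤ hi → s < lo + suc (hi ∸ lo) → s ≤ hi
<-interval-end {s = s} lo≤hi s<end = s≤s⁻¹ (subst (s <_) (trans (+-suc _ _) (cong suc (m+[n∸m]≡n lo≤hi))) s<end)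

-- The updown-core of B_a

inB⁺ : ∀ {a x y} → 1 ≤ x → x ≤ a → 1 ≤ y → y ≤ a → a < x + y → T (inB a (x , y))
inB⁺ 1≤x x≤a 1≤y y≤a a<x+y =
  T-∧-intro (≤⇒≤ᵇ 1≤x) (T-∧-intro (≤⇒≤ᵇ x≤a) (T-∧-intro (≤⇒≤ᵇ 1≤y) (T-∧-intro (≤⇒≤ᵇ y≤a) (≤⇒≤ᵇ a<x+y))))

inB⁻ : ∀ {a x y} → T (inB a (x , y)) → 1 ≤ x × x ≤ a × 1 ≤ y × y ≤ a × a < x + y
inB⁻ {a} {x} {y} t =
  let (t₁ , t) = Equivalence.to T-∧ t
      (t₂ , t) = Equivalence.to T-∧ t
      (t₃ , t) = Equivalence.to T-∧ t
      (t₄ , t₅) = Equivalence.to T-∧ t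
  in ≤ᵇ⇒≤ 1 x t₁ , ≤ᵇ⇒≤ x a t₂ , ≤ᵇ⇒≤ 1 y t₃ , ≤ᵇ⇒≤ y a t₄ , ≤ᵇ⇒≤ (suc a) (x + y) t₅

inB-false : ∀ {a x y} → x + y ≤ a → inB a (x , y) ≡ false
inB-false {a} {x} {y} x+y≤a with inB a (x , y) in x,y∈B
... | true  = let (_ , _ , _ , _ , a<x+y) = inB⁻ {a} {x} {y} (Equivalence.from T-≡ x,y∈B) in ⊥-elim (<⇒≱ a<x+y x+y≤a)
... | false = refl

-- udAdj (inB a) restricted to B_a: a rectangle in [1, a]² lies in B_a iff its lower-left corner does.
adjB : ℕ → Box → Box → Bool
adjB a (i , j) (k , l) = not (boxEq (i , j) (k , l)) ∧ (suc a ≤ᵇ i ⊓ k + j ⊓ l)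

rectangle⊆B : ∀ {a lo₁ hi₁ lo₂ hi₂} →
  1 ≤ lo₁ → lo₁ ≤ hi₁ → hi₁ ≤ a → 1 ≤ lo₂ → lo₂ ≤ hi₂ → hi₂ ≤ a →
  allB (λ s → allB (λ t → inB a (s , t)) (range lo₂ hi₂)) (range lo₁ hi₁) ≡ (suc a ≤ᵇ lo₁ + lo₂)
rectangle⊆B {a} {lo₁} {hi₁} {lo₂} {hi₂} 1≤lo₁ lo₁≤hi₁ hi₁≤a 1≤lo₂ lo₂≤hi₂ hi₂≤a
  rewrite range≡interval lo₁ hi₁ | range≡interval lo₂ hi₂ | +-∸-assoc 1 lo₁≤hi₁ | +-∸-assoc 1 lo₂≤hi₂
  with a <? lo₁ + lo₂
... | yes a<lo₁+lo₂ = trans (Equivalence.to T-≡ (allB⁺ (All-interval lo₁ _ λ lo₁≤s s<end₁ →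
        allB⁺ (All-interval lo₂ _ λ lo₂≤t t<end₂ →
          inB⁺ (≤-trans 1≤lo₁ lo₁≤s) (≤-trans (<-interval-end lo₁≤hi₁ s<end₁) hi₁≤a)
               (≤-trans 1≤lo₂ lo₂≤t) (≤-trans (<-interval-end lo₂≤hi₂ t<end₂) hi₂≤a)
               (<-≤-trans a<lo₁+lo₂ (+-mono-≤ lo₁≤s lo₂≤t))))))
      (sym (dec-true (suc a ≤? lo₁ + lo₂) a<lo₁+lo₂))
... | no a≮lo₁+lo₂ rewrite inB-false {a} {lo₁} {lo₂} (≮⇒≥ a≮lo₁+lo₂) =
  sym (dec-false (suc a ≤? lo₁ + lo₂) a≮lo₁+lo₂)

udAdj≡adjB : ∀ {a} v w → T (inB a v) → T (inB a w) → udAdj (inB a) v w ≡ adjB a v w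
udAdj≡adjB (i , j) (k , l) v∈B w∈B =
  let (1≤i , i≤a , 1≤j , j≤a , _) = inB⁻ v∈B
      (1≤k , k≤a , 1≤l , l≤a , _) = inB⁻ w∈B
  in cong (not (boxEq (i , j) (k , l)) ∧_)
       (rectangle⊆B (⊓-glb 1≤i 1≤k) (m⊓n≤m⊔n i k) (⊔-lub i≤a k≤a)
                    (⊓-glb 1≤j 1≤l) (m⊓n≤m⊔n j l) (⊔-lub j≤a l≤a))

boxEq-≢ : ∀ {i j k l} → i ≢ k ⊎ j ≢ l → boxEq (i , j) (k , l) ≡ false
boxEq-≢ {i} {j} {k} {l} (inj₁ i≢k) = cong (_∧ (j ≡ᵇ l)) (dec-false (i ≟ k) i≢k)
boxEq-≢ {i} {j} {k} {l} (inj₂ j≢l) = trans (cong ((i ≡ᵇ k) ∧_) (dec-false (j ≟ l) j≢l)) (∧-zeroʳ (i ≡ᵇ k))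

adjB-vertical : ∀ {a x y y'} → y < y' → a < x + y → T (adjB a (x , y) (x , y'))
adjB-vertical {a} {x} {y} {y'} y<y' a<x+y =
  T-∧-intro (Equivalence.from T-not-≡ (boxEq-≢ {x} {y} {x} {y'} (inj₂ (<⇒≢ y<y'))))
            (≤⇒≤ᵇ (subst (a <_) (sym (cong₂ _+_ (⊓-idem x) (m≤n⇒m⊓n≡m (<⇒≤ y<y')))) a<x+y))

adjB-rightOf : ∀ {a c x y y'} → c < x → adjB a (c , y) (x , y') ≡ (suc a ≤ᵇ c + y ⊓ y')
adjB-rightOf {a} {c} {x} {y} {y'} c<x =
  cong₂ (λ e m → not e ∧ (suc a ≤ᵇ m + y ⊓ y'))
        (boxEq-≢ {c} {y} {x} {y'} (inj₁ (<⇒≢ c<x))) (m≤n⇒m⊓n≡m (<⇒≤ c<x))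

shift : ℕ → Box → Box
shift c (u , v) = (u + c , v)

adjB-shift : ∀ c n v w → adjB (c + n) (shift c v) (shift c w) ≡ adjB n v w
adjB-shift c n (u , v) (u' , v') =
  cong₂ (λ e b → not (e ∧ (v ≡ᵇ v')) ∧ b)
    (does-⇔ (mk⇔ (+-cancelʳ-≡ c u u') (cong (_+ c))) (u + c ≟ u' + c) (u ≟ u'))
    (trans (cong (λ m → suc (c + n) ≤ᵇ m + v ⊓ v') (sym (+-distribʳ-⊓ c u u')))
           (does-⇔ (mk⇔ (λ lt → +-cancelˡ-< c n _ (subst (c + n <_) regroup lt))
                        (λ lt → subst (c + n <_) (sym regroup) (+-monoʳ-< c lt)))
                   (_ ≤? _) (_ ≤? _)))
  where
  regroup : u ⊓ u' + c + v ⊓ v' ≡ c + (u ⊓ u' + v ⊓ v')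
  regroup = trans (cong (_+ v ⊓ v') (+-comm (u ⊓ u') c)) (+-assoc c (u ⊓ u') (v ⊓ v'))

column : ℕ → ℕ → List Box
column a x = map (x ,_) (interval (suc (a ∸ x)) x)

columns : ℕ → ℕ → ℕ → List Box
columns a c n = concatMap (column a) (interval c n)

staircase : ℕ → List Box
staircase a = columns a 1 a

column-of-grid : ∀ {a x} → 1 ≤ x → x ≤ a → filterᵇ (inB a) (map (x ,_) (interval 1 a)) ≡ column a x
column-of-grid {a} {x} 1≤x x≤a = begin
    filterᵇ (inB a) (map (x ,_) (interval 1 a))
  ≡⟨ filterᵇ-map (inB a) (x ,_) (interval 1 a) ⟩
    map (x ,_) (filterᵇ (λ y → inB a (x , y)) (interval 1 a))
  ≡⟨ cong (λ a' → map (x ,_) (filterᵇ (λ y → inB a (x , y)) (interval 1 a'))) (m∸n+n≡m x≤a) ⟨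
    map (x ,_) (filterᵇ (λ y → inB a (x , y)) (interval 1 (a ∸ x + x)))
  ≡⟨ cong (map (x ,_) ∘ filterᵇ (λ y → inB a (x , y))) (interval-++ 1 (a ∸ x) x) ⟩
    map (x ,_) (filterᵇ (λ y → inB a (x , y)) (interval 1 (a ∸ x) ++ interval (suc (a ∸ x)) x))
  ≡⟨ cong (map (x ,_)) (filterᵇ-++-none-all below above) ⟩
    column a x ∎
  where
  open ≡-Reasoning
  x+[a∸x]≡a : x + (a ∸ x) ≡ a
  x+[a∸x]≡a = m+[n∸m]≡n x≤a
  below : All (λ y → ¬ T (inB a (x , y))) (interval 1 (a ∸ x))
  below = All-interval 1 (a ∸ x) λ {y} _ y<end →
    subst T (inB-false {a} {x} {y} (subst (x + y ≤_) x+[a∸x]≡a (+-monoʳ-≤ x (s≤s⁻¹ y<end))))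
  above : All (λ y → T (inB a (x , y))) (interval (suc (a ∸ x)) x)
  above = All-interval (suc (a ∸ x)) x λ {y} start≤y y<end →
    inB⁺ 1≤x x≤a (≤-trans (s≤s z≤n) start≤y) (s≤s⁻¹ (subst (y <_) (cong suc (m∸n+n≡m x≤a)) y<end))
         (subst (_≤ x + y) (trans (+-suc x (a ∸ x)) (cong suc x+[a∸x]≡a)) (+-monoʳ-≤ x start≤y))

boxesB≡staircase : ∀ a → boxesB a ≡ staircase a
boxesB≡staircase a = begin
    boxesB a
  ≡⟨ filter-≐ (λ b → inB a b Data.Bool.≟ true) (T? ∘ inB a)
               (Equivalence.from T-≡ , Equivalence.to T-≡) (grid (range 1 a)) ⟩
    filterᵇ (inB a) (grid (range 1 a))
  ≡⟨ cong (filterᵇ (inB a) ∘ grid) (range≡interval 1 a) ⟩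
    filterᵇ (inB a) (grid (interval 1 a))
  ≡⟨ filterᵇ-concatMap (inB a) (λ x → map (x ,_) (interval 1 a)) (interval 1 a) ⟩
    concatMap (λ x → filterᵇ (inB a) (map (x ,_) (interval 1 a))) (interval 1 a)
  ≡⟨ cong concat (map-cong-local (All-interval 1 a λ 1≤x x<1+a → column-of-grid 1≤x (s≤s⁻¹ x<1+a))) ⟩
    staircase a ∎
  where
  open ≡-Reasoning
  grid : List ℕ → List Box
  grid is = concatMap (λ x → map (x ,_) is) is

column-clique : ∀ {a x} → x ≤ a → AllPairs (λ v w → T (adjB a v w)) (column a x)
column-clique {a} {x} x≤a = AllPairs.map⁺ (AllPairs-interval (suc (a ∸ x)) x λ {y} start≤y y<y' →
  adjB-vertical y<y' (subst (_≤ x + y) (trans (+-suc x (a ∸ x)) (cong suc (m+[n∸m]≡n x≤a))) (+-monoʳ-≤ x start≤y)))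

column-nonNeighbours : ∀ {c n u y} → 1 ≤ u → u ≤ n → n < y →
  filterᵇ (not ∘ adjB (c + n) (c , y)) (column (c + n) (u + c)) ≡ map (shift c) (column n u)
column-nonNeighbours {c} {n} {u} {y} 1≤u u≤n n<y = begin
    filterᵇ (not ∘ adjB (c + n) (c , y)) (map (u + c ,_) (interval (suc (c + n ∸ (u + c))) (u + c)))
  ≡⟨ filterᵇ-map (not ∘ adjB (c + n) (c , y)) (u + c ,_) (interval (suc (c + n ∸ (u + c))) (u + c)) ⟩
    map (u + c ,_) (filterᵇ nonAdj (interval (suc (c + n ∸ (u + c))) (u + c)))
  ≡⟨ cong (λ m → map (u + c ,_) (filterᵇ nonAdj (interval (suc m) (u + c)))) start ⟩
    map (u + c ,_) (filterᵇ nonAdj (interval (suc (n ∸ u)) (u + c)))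
  ≡⟨ cong (map (u + c ,_) ∘ filterᵇ nonAdj) (interval-++ (suc (n ∸ u)) u c) ⟩
    map (u + c ,_) (filterᵇ nonAdj (interval (suc (n ∸ u)) u ++ interval (suc (n ∸ u) + u) c))
  ≡⟨ cong (map (u + c ,_)) (filterᵇ-++-all-none low high) ⟩
    map (u + c ,_) (interval (suc (n ∸ u)) u)
  ≡⟨ map-∘ _ ⟩
    map (shift c) (column n u) ∎
  where
  open ≡-Reasoning
  nonAdj : ℕ → Bool
  nonAdj y' = not (adjB (c + n) (c , y) (u + c , y'))
  start : c + n ∸ (u + c) ≡ n ∸ u
  start = trans (cong (c + n ∸_) (+-comm u c)) ([m+n]∸[m+o]≡n∸o c n u)
  c<u+c : c < u + c
  c<u+c = m<n+m c 1≤u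
  end : suc (n ∸ u) + u ≡ suc n
  end = cong suc (m∸n+n≡m u≤n)
  low : All (T ∘ nonAdj) (interval (suc (n ∸ u)) u)
  low = All-interval (suc (n ∸ u)) u λ {y'} _ y'<end →
    subst (T ∘ not) (sym (adjB-rightOf c<u+c))
      (Equivalence.from T-not-≡ (dec-false (suc (c + n) ≤? c + y ⊓ y')
        (≤⇒≯ (+-monoʳ-≤ c (≤-trans (m⊓n≤n y y') (s≤s⁻¹ (subst (y' <_) end y'<end)))))))
  high : All (¬_ ∘ T ∘ nonAdj) (interval (suc (n ∸ u) + u) c)
  high = All-interval (suc (n ∸ u) + u) c λ {y'} end≤y' _ →
    T⇒¬T-not (subst T (sym (adjB-rightOf c<u+c))
      (≤⇒≤ᵇ (+-monoʳ-< c (⊓-pres-m< n<y (subst (_≤ y') end end≤y')))))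

nonNeighbours≡shiftedStaircase : ∀ c n {y} → n < y →
  filterᵇ (not ∘ adjB (c + n) (c , y)) (columns (c + n) (suc c) n) ≡ map (shift c) (staircase n)
nonNeighbours≡shiftedStaircase c n {y} n<y = begin
    filterᵇ nonAdj (concatMap (column (c + n)) (interval (suc c) n))
  ≡⟨ cong (filterᵇ nonAdj ∘ concatMap (column (c + n))) (map-interval (_+ c) (λ _ → refl) 1 n) ⟨
    filterᵇ nonAdj (concatMap (column (c + n)) (map (_+ c) (interval 1 n)))
  ≡⟨ cong (filterᵇ nonAdj) (concatMap-map (column (c + n)) (_+ c) (interval 1 n)) ⟩
    filterᵇ nonAdj (concatMap (λ u → column (c + n) (u + c)) (interval 1 n))
  ≡⟨ filterᵇ-concatMap nonAdj (λ u → column (c + n) (u + c)) (interval 1 n) ⟩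
    concatMap (λ u → filterᵇ nonAdj (column (c + n) (u + c))) (interval 1 n)
  ≡⟨ cong concat (map-cong-local (All-interval 1 n λ 1≤u u<1+n → column-nonNeighbours 1≤u (s≤s⁻¹ u<1+n) n<y)) ⟩
    concatMap (map (shift c) ∘ column n) (interval 1 n)
  ≡⟨ map-concatMap (shift c) (column n) (interval 1 n) ⟨
    map (shift c) (staircase n) ∎
  where
  open ≡-Reasoning
  nonAdj : Box → Bool
  nonAdj = not ∘ adjB (c + n) (c , y)

-- The column recurrence

r≡staircase : ∀ a k → r a k ≡ independentCount (adjB a) (staircase a) k
r≡staircase a k = begin
    r a k
  ≡⟨ count-independent (inB a) (boxesB a) k ⟩
    independentCount (udAdj (inB a)) (boxesB a) k
  ≡⟨ independentCount-cong (λ b → inB a b ≡ true)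
       (λ {v} {w} v∈B w∈B → udAdj≡adjB v w (Equivalence.from T-≡ v∈B) (Equivalence.from T-≡ w∈B))
       (all-filter (λ b → inB a b Data.Bool.≟ true) (concatMap (λ x → map (x ,_) (range 1 a)) (range 1 a))) k ⟩
    independentCount (adjB a) (boxesB a) k
  ≡⟨ cong (λ bs → independentCount (adjB a) bs k) (boxesB≡staircase a) ⟩
    independentCount (adjB a) (staircase a) k ∎
  where open ≡-Reasoning

nonNeighbours-count : ∀ c n {y} k → n < y →
  independentCount (adjB (c + n)) (filterᵇ (not ∘ adjB (c + n) (c , y)) (columns (c + n) (suc c) n)) k ≡ r n k
nonNeighbours-count c n k n<y = begin
    independentCount (adjB (c + n)) (filterᵇ (not ∘ adjB (c + n) (c , _)) (columns (c + n) (suc c) n)) k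
  ≡⟨ cong (λ bs → independentCount (adjB (c + n)) bs k) (nonNeighbours≡shiftedStaircase c n n<y) ⟩
    independentCount (adjB (c + n)) (map (shift c) (staircase n)) k
  ≡⟨ independentCount-map (shift c) (adjB-shift c n) (staircase n) k ⟩
    independentCount (adjB n) (staircase n) k
  ≡⟨ r≡staircase n k ⟨
    r n k ∎
  where open ≡-Reasoning

sum-map-const : ∀ {f : A → ℕ} {v xs} → All (λ x → f x ≡ v) xs → sum (map f xs) ≡ length xs * v
sum-map-const [] = refl
sum-map-const (fx≡v ∷ fxs≡v) = cong₂ _+_ fx≡v (sum-map-const fxs≡v)

-- weighted k c n = Σ_{j<n} (c + j) · r (n ∸ 1 ∸ j) k
weighted : ℕ → ℕ → ℕ → ℕ
weighted k c zero = 0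
weighted k c (suc n) = c * r n k + weighted k (suc c) n

columns-count : ∀ {a} k c n → c + n ≡ suc a → independentCount (adjB a) (columns a c n) (suc k) ≡ weighted k c n
columns-count k c zero _ = refl
columns-count {a} k c (suc m) c+n≡1+a with refl ← suc-injective (trans (sym (+-suc c m)) c+n≡1+a) = begin
    independentCount (adjB a) (column a c ++ columns a (suc c) m) (suc k)
  ≡⟨ independentCount-clique-++ (adjB a) (column-clique (m≤m+n c m)) (columns a (suc c) m) k ⟩
    independentCount (adjB a) (columns a (suc c) m) (suc k) + sum (map choices (column a c))
  ≡⟨ cong₂ _+_ (columns-count k (suc c) m refl) (sum-map-const (All.map⁺ (All-interval _ c λ {y} start≤y _ →
       nonNeighbours-count c m k (subst (_≤ y) (cong suc (m+n∸m≡n c m)) start≤y)))) ⟩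
    weighted k (suc c) m + length (column a c) * r m k
  ≡⟨ cong (λ l → weighted k (suc c) m + l * r m k) (trans (length-map _ (interval _ c)) (length-interval _ c)) ⟩
    weighted k (suc c) m + c * r m k
  ≡⟨ +-comm (weighted k (suc c) m) (c * r m k) ⟩
    weighted k c (suc m) ∎
  where
  open ≡-Reasoning
  choices : Box → ℕ
  choices b = independentCount (adjB a) (filterᵇ (not ∘ adjB a b) (columns a (suc c) m)) k

r-suc : ∀ a k → r a (suc k) ≡ weighted k 1 a
r-suc a k = trans (r≡staircase a (suc k)) (columns-count k 1 a refl)

suc-*-+-regroup : ∀ c x w s → suc c * x + (w + s) ≡ (c * x + w) + (s + x)
suc-*-+-regroup = solve-∀

weighted-suc : ∀ k c n → weighted k (suc c) (suc n) ≡ weighted k c (suc n) + sumTo n (λ i → r i k)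
weighted-suc k c zero = suc-*-+-regroup c (r 0 k) 0 0
weighted-suc k c (suc n) =
  trans (cong (suc c * r (suc n) k +_) (weighted-suc k (suc c) n))
        (suc-*-+-regroup c (r (suc n) k) (weighted k (suc c) (suc n)) (sumTo n (λ i → r i k)))

r-suc-suc : ∀ a k → r (suc a) (suc k) ≡ r a (suc k) + sumTo a (λ i → r i k)
r-suc-suc a k = begin
    r (suc a) (suc k)                          ≡⟨ r-suc (suc a) k ⟩
    weighted k 1 (suc a)                       ≡⟨ weighted-suc k 0 a ⟩
    weighted k 1 a + sumTo a (λ i → r i k)     ≡⟨ cong (_+ sumTo a (λ i → r i k)) (r-suc a k) ⟨
    r a (suc k) + sumTo a (λ i → r i k)        ∎
  where open ≡-Reasoning

-- Power series coefficients

sumTo-cong : ∀ n {f g : ℕ → ℕ} → (∀ {i} → i ≤ n → f i ≡ g i) → sumTo n f ≡ sumTo n g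
sumTo-cong zero f≗g = f≗g z≤n
sumTo-cong (suc n) f≗g = cong₂ _+_ (sumTo-cong n (λ i≤n → f≗g (m≤n⇒m≤1+n i≤n))) (f≗g ≤-refl)

sumTo-zeros : ∀ n → sumTo n (λ _ → 0) ≡ 0
sumTo-zeros zero = refl
sumTo-zeros (suc n) = trans (+-identityʳ _) (sumTo-zeros n)

sumTo-shift : ∀ n (f : ℕ → ℕ) → sumTo (suc n) f ≡ f 0 + sumTo n (λ i → f (suc i))
sumTo-shift zero f = refl
sumTo-shift (suc n) f = trans (cong (_+ f (suc (suc n))) (sumTo-shift n f)) (+-assoc (f 0) _ _)

sumTo-if : ∀ n b (f : ℕ → ℕ) → sumTo n (λ i → if b then f i else 0) ≡ (if b then sumTo n f else 0)
sumTo-if n true f = refl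
sumTo-if n false f = sumTo-zeros n

-- p <ᵇ suc n rather than p ≤ᵇ n: it computes on p = 0 and on successors
sumTo-indicator : ∀ n p (f : ℕ → ℕ) → sumTo n (λ i → if i ≡ᵇ p then f i else 0) ≡ (if p <ᵇ suc n then f p else 0)
sumTo-indicator zero zero f = refl
sumTo-indicator zero (suc p) f = refl
sumTo-indicator (suc n) zero f = trans (sumTo-shift n _) (trans (cong (f 0 +_) (sumTo-zeros n)) (+-identityʳ (f 0)))
sumTo-indicator (suc n) (suc p) f = trans (sumTo-shift n _) (sumTo-indicator n p (λ i → f (suc i)))

IsMonomial : ℕ → ℕ → PS → Set
IsMonomial p q g = ∀ i j → g i j ≡ (if i ≡ᵇ p then (if j ≡ᵇ q then 1 else 0) else 0)

⊛-monomial : ∀ {p q g} → IsMonomial p q g → ∀ f a k →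
  (g ⊛ f) a k ≡ (if p <ᵇ suc a then (if q <ᵇ suc k then f (a ∸ p) (k ∸ q) else 0) else 0)
⊛-monomial {p} {q} {g} g-monomial f a k = begin
    sumTo a (λ i → sumTo k (λ j → g i j * f (a ∸ i) (k ∸ j)))
  ≡⟨ sumTo-cong a (λ {i} _ → sumTo-cong k (λ {j} _ → term i j)) ⟩
    sumTo a (λ i → sumTo k (λ j → if i ≡ᵇ p then (if j ≡ᵇ q then f (a ∸ i) (k ∸ j) else 0) else 0))
  ≡⟨ sumTo-cong a (λ {i} _ → sumTo-if k (i ≡ᵇ p) _) ⟩
    sumTo a (λ i → if i ≡ᵇ p then sumTo k (λ j → if j ≡ᵇ q then f (a ∸ i) (k ∸ j) else 0) else 0)
  ≡⟨ sumTo-indicator a p _ ⟩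
    (if p <ᵇ suc a then sumTo k (λ j → if j ≡ᵇ q then f (a ∸ p) (k ∸ j) else 0) else 0)
  ≡⟨ cong (λ s → if p <ᵇ suc a then s else 0) (sumTo-indicator k q _) ⟩
    (if p <ᵇ suc a then (if q <ᵇ suc k then f (a ∸ p) (k ∸ q) else 0) else 0) ∎
  where
  open ≡-Reasoning
  term : ∀ i j → g i j * f (a ∸ i) (k ∸ j) ≡ (if i ≡ᵇ p then (if j ≡ᵇ q then f (a ∸ i) (k ∸ j) else 0) else 0)
  term i j rewrite g-monomial i j with i ≡ᵇ p | j ≡ᵇ q
  ... | true  | true  = +-identityʳ _
  ... | true  | false = refl
  ... | false | _     = refl

sumTo-geomX : ∀ (f : ℕ → ℕ) b k → sumTo k (λ j → f j * geomX b (k ∸ j)) ≡ f k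
sumTo-geomX f b zero = *-identityʳ (f 0)
sumTo-geomX f b (suc k) = cong₂ _+_ earlier last
  where
  earlier : sumTo k (λ j → f j * geomX b (suc k ∸ j)) ≡ 0
  earlier = trans (sumTo-cong k (λ {j} j≤k → cong (λ m → f j * geomX b m) (+-∸-assoc 1 j≤k)))
                  (trans (sumTo-cong k (λ {j} _ → *-zeroʳ (f j))) (sumTo-zeros k))
  last : f (suc k) * geomX b (k ∸ k) ≡ f (suc k)
  last = trans (cong (λ m → f (suc k) * geomX b m) (n∸n≡0 k)) (*-identityʳ (f (suc k)))

⊛-geomX : ∀ g a k → (g ⊛ geomX) a k ≡ sumTo a (λ i → g i k)
⊛-geomX g a k = sumTo-cong a (λ {i} _ → sumTo-geomX (g i) (a ∸ i) k)

X-monomial : IsMonomial 1 0 X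
X-monomial zero j = refl
X-monomial (suc zero) zero = refl
X-monomial (suc zero) (suc j) = refl
X-monomial (suc (suc i)) j = refl

Y-monomial : IsMonomial 0 1 Y
Y-monomial zero zero = refl
Y-monomial zero (suc zero) = refl
Y-monomial zero (suc (suc j)) = refl
Y-monomial (suc i) j = refl

XY-monomial : IsMonomial 1 1 (X ⊛ Y)
XY-monomial zero j = ⊛-monomial X-monomial Y 0 j
XY-monomial (suc i) j = trans (⊛-monomial X-monomial Y (suc i) j) (Y-monomial i j)

-- 1 + xF + xyF/(1 − x), coefficientwise
expandedRHS : PS → PS
expandedRHS F a k =
  one a k + (if 0 <ᵇ a then F (a ∸ 1) k else 0)
          + sumTo a (λ i → if 0 <ᵇ i then (if 0 <ᵇ k then F (i ∸ 1) (k ∸ 1) else 0) else 0)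

rhs≡expandedRHS : ∀ F a k → (one ⊕ X ⊛ F ⊕ X ⊛ Y ⊛ F ⊛ geomX) a k ≡ expandedRHS F a k
rhs≡expandedRHS F a k =
  cong₂ (λ s t → one a k + s + t) (⊛-monomial X-monomial F a k)
    (trans (⊛-geomX (X ⊛ Y ⊛ F) a k) (sumTo-cong a (λ {i} _ → ⊛-monomial XY-monomial F i k)))

r≡expandedRHS : ∀ a k → r a k ≡ expandedRHS r a k
r≡expandedRHS zero zero = r≡staircase 0 0
r≡expandedRHS (suc a) zero =
  trans (r≡staircase (suc a) 0)
        (sym (cong₂ _+_ (r≡staircase a 0) (trans (sumTo-cong (suc a) (λ {i} _ → if-eta (0 <ᵇ i))) (sumTo-zeros (suc a)))))
r≡expandedRHS zero (suc k) = r-suc 0 k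
r≡expandedRHS (suc a) (suc k) = trans (r-suc-suc a k) (cong (r a (suc k) +_) (sym (sumTo-shift a _)))

mainTheorem10 : (a k : ℕ) → R a k ≡ (one ⊕ X ⊛ R ⊕ X ⊛ Y ⊛ R ⊛ geomX) a k
mainTheorem10 a k = trans (r≡expandedRHS a k) (sym (rhs≡expandedRHS R a k))
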